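{- For every integer $r\ge2$, $br(r;3,3)\le 4r^3+1$.
   Context: The bipartite $r$-colour Ramsey number $br(r;s,t)$ is the least integer $N$ such that every colouring of the edges of the complete bipartite graph $K_{N,N}$ with $r$ colours contains a monochromatic copy of $K_{s,t}$. -}

module Defs where

open import Data.Nat using (ℕ; _<_)
open import Data.Fin using (Fin)
open import Data.Product using (Σ; _×_)
open import Data.Sum using (_⊎_)
open import Function.Definitions using (Injective)
open import Relation.Binary.PropositionalEquality using (_≡_)
open import Relation.Nullary using (¬_)

-- An r-colouring of the edges of K_{N,N}: the edge between left vertex i
-- and right vertex j receives colour χ i j.
EdgeColouring : ℕ → ℕ → Set
EdgeColouring r N = Fin N → Fin N → Fin r

MonoLR : ∀ {r N} → EdgeColouring r N → ℕ → ℕ → Set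
MonoLR {r} {N} χ s t =
  Σ (Fin r) λ c →
  Σ (Fin s → Fin N) λ a →
  Σ (Fin t → Fin N) λ b →
    Injective _≡_ _≡_ a × Injective _≡_ _≡_ b ×
    ((i : Fin s) (j : Fin t) → χ (a i) (b j) ≡ c)

HasMonoK : ∀ {r N} → EdgeColouring r N → ℕ → ℕ → Set
HasMonoK χ s t = MonoLR χ s t ⊎ MonoLR (λ i j → χ j i) s t

RamseyProp : ℕ → ℕ → ℕ → ℕ → Set
RamseyProp r s t N = (χ : EdgeColouring r N) → HasMonoK χ s t

IsBR : ℕ → ℕ → ℕ → ℕ → Set
IsBR r s t N = RamseyProp r s t N × ((M : ℕ) → M < N → ¬ RamseyProp r s t M)

-- Double counting.  Fix an r-colouring of K_{N,N} with N = r m.  For a right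
-- vertex j, the left vertices split into r colour classes whose sizes sum to
-- N, so by convexity of d ↦ d(d-1)(d-2) they span at least r·m(m-1)(m-2)
-- ordered triples of distinct left vertices joined to j in a single colour.
-- Summed over j this is at least N r m(m-1)(m-2).  If no colour class of a
-- triple had three common neighbours, the same quantity would be at most
-- 2 r N³, which is smaller as soon as 2N² < m(m-1)(m-2); taking m = 4r²
-- gives N = 4r³.  Since the Ramsey property is decidable, the least such N
-- exists and is at most 4r³.
module Submission where

open import Data.Fin using (Fin; zero; suc) renaming (_≟_ to _≟ᶠ_)
open import Data.Fin.Properties using (any?; all?)
open import Data.Nat
  using (ℕ; zero; suc; _+_; _*_; _∸_; _^_; _≤_; _<_; z≤n; s≤s; z<s; _<?_; NonZero;
         compare; less; equal; greater)
open import Data.Nat.Induction using (<-rec)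
open import Data.Nat.Properties
open import Data.Nat.Tactic.RingSolver using (solve-∀)
open import Data.Product using (Σ; ∃; _×_; _,_; proj₁; proj₂)
open import Data.Sum using (inj₁; inj₂)
open import Data.Vec.Functional using ([]; _∷_; head; tail)
open import Data.Vec.Functional.Relation.Binary.Pointwise using (Pointwise)
open import Function using (_∘_; flip)
open import Function.Definitions using (Injective)
open import Level using (0ℓ)
open import Relation.Binary.Definitions using (Reflexive; _Respects_)
open import Relation.Binary.PropositionalEquality
  using (_≡_; _≢_; _≗_; refl; sym; trans; cong; cong₂; subst; subst₂; module ≡-Reasoning)
open import Relation.Nullary using (¬_; Dec; yes; no; contradiction)
open import Relation.Nullary.Decidable
  using (map′; _×-dec_; _⊎-dec_; _→-dec_; ¬?; decidable-stable)
open import Relation.Unary using (Pred; Decidable)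

open import Algebra.Properties.Semiring.Sum +-*-semiring
  using (sum-syntax; sum-cong-≗; sum-replicate-zero; ∑-comm; ∑-distrib-+; *-distribˡ-sum; *-distribʳ-sum)

open import Defs

∑-mono-≤ : ∀ {n} {f g : Fin n → ℕ} → (∀ i → f i ≤ g i) → ∑[ i < n ] f i ≤ ∑[ i < n ] g i
∑-mono-≤ {zero}  f≤g = z≤n
∑-mono-≤ {suc n} f≤g = +-mono-≤ (f≤g zero) (∑-mono-≤ (f≤g ∘ suc))

∑-const : ∀ n k → ∑[ i < n ] k ≡ n * k
∑-const zero    k = refl
∑-const (suc n) k = cong (k +_) (∑-const n k)

∑-pigeonhole : ∀ {n} k (f : Fin n → ℕ) → n * k < ∑[ i < n ] f i → ∃ λ i → k < f i
∑-pigeonhole {n} k f large with any? (λ i → k <? f i)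
... | yes found = found
... | no none = contradiction bounded (<⇒≱ large)
  where
  bounded : ∑[ i < n ] f i ≤ n * k
  bounded = subst (_ ≤_) (∑-const n k) (∑-mono-≤ λ i → ≮⇒≥ (λ k<fi → none (i , k<fi)))

1≤m*n⇒1≤m∧1≤n : ∀ {m n} → 1 ≤ m * n → 1 ≤ m × 1 ≤ n
1≤m*n⇒1≤m∧1≤n {suc m} {suc n} _ = s≤s z≤n , s≤s z≤n
1≤m*n⇒1≤m∧1≤n {suc m} {zero}  p = contradiction (subst (1 ≤_) (*-zeroʳ m) p) λ ()

δ : ∀ {n} → Fin n → Fin n → ℕ
δ zero    zero    = 1
δ zero    (suc _) = 0
δ (suc _) zero    = 0
δ (suc i) (suc j) = δ i j

ν : ∀ {n} → Fin n → Fin n → ℕ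
ν i j = 1 ∸ δ i j

δ-refl : ∀ {n} (i : Fin n) → δ i i ≡ 1
δ-refl zero    = refl
δ-refl (suc i) = δ-refl i

δ≤1 : ∀ {n} (i j : Fin n) → δ i j ≤ 1
δ≤1 zero    zero    = s≤s z≤n
δ≤1 zero    (suc _) = z≤n
δ≤1 (suc _) zero    = z≤n
δ≤1 (suc i) (suc j) = δ≤1 i j

ν≤1 : ∀ {n} (i j : Fin n) → ν i j ≤ 1
ν≤1 i j = m∸n≤m 1 (δ i j)

1≤δ⇒≡ : ∀ {n} {i j : Fin n} → 1 ≤ δ i j → i ≡ j
1≤δ⇒≡ {i = zero}  {zero}  _ = refl
1≤δ⇒≡ {i = suc i} {suc j} p = cong suc (1≤δ⇒≡ p)

1≤ν⇒≢ : ∀ {n} {i j : Fin n} → 1 ≤ ν i j → i ≢ j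
1≤ν⇒≢ {i = i} p refl = contradiction (subst (λ d → 1 ≤ 1 ∸ d) (δ-refl i) p) λ ()

∑-δ : ∀ {n} (i : Fin n) → ∑[ j < n ] δ i j ≡ 1
∑-δ {suc n} zero    = cong suc (sum-replicate-zero n)
∑-δ {suc n} (suc i) = ∑-δ i

δ-ν-split : ∀ {n} (f : Fin n → ℕ) i j → f j ≡ f i * δ i j + f j * ν i j
δ-ν-split f zero    zero    = sym (trans (cong₂ _+_ (*-identityʳ (f zero)) (*-zeroʳ (f zero))) (+-identityʳ _))
δ-ν-split f zero    (suc j) = sym (cong₂ _+_ (*-zeroʳ (f zero)) (*-identityʳ (f (suc j))))
δ-ν-split f (suc i) zero    = sym (cong₂ _+_ (*-zeroʳ (f (suc i))) (*-identityʳ (f zero)))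
δ-ν-split f (suc i) (suc j) = δ-ν-split (f ∘ suc) i j

∑-split : ∀ {n} (f : Fin n → ℕ) i → ∑[ j < n ] f j ≡ f i + ∑[ j < n ] (f j * ν i j)
∑-split {n} f i = begin
  ∑[ j < n ] f j                           ≡⟨ sum-cong-≗ (δ-ν-split f i) ⟩
  ∑[ j < n ] (f i * δ i j + f j * ν i j)  ≡⟨ ∑-distrib-+ (λ j → f i * δ i j) (λ j → f j * ν i j) ⟩
  ∑[ j < n ] (f i * δ i j) + rest          ≡⟨ cong (_+ rest) (*-distribˡ-sum (f i) (δ i)) ⟨
  f i * ∑[ j < n ] δ i j + rest            ≡⟨ cong (λ s → f i * s + rest) (∑-δ i) ⟩
  f i * 1 + rest                           ≡⟨ cong (_+ rest) (*-identityʳ (f i)) ⟩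
  f i + rest                               ∎
  where
  open ≡-Reasoning
  rest = ∑[ j < n ] (f j * ν i j)

∑-remove : ∀ {n} {f : Fin n → ℕ} → (∀ j → f j ≤ 1) → ∀ i →
           ∑[ j < n ] f j ≤ 1 + ∑[ j < n ] (f j * ν i j)
∑-remove {n} {f} f≤1 i =
  ≤-trans (≤-reflexive (∑-split f i)) (+-monoˡ-≤ (∑[ j < n ] (f j * ν i j)) (f≤1 i))

∷-injective : ∀ {n m} {x : Fin m} {e : Fin n → Fin m} →
              (∀ i → x ≢ e i) → Injective _≡_ _≡_ e → Injective _≡_ _≡_ (x ∷ e)
∷-injective {x = x} {e} x∉e e-inj = inj
  where
  inj : Injective _≡_ _≡_ (x ∷ e)
  inj {zero}  {zero}  _  = refl
  inj {zero}  {suc j} eq = contradiction eq (x∉e j)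
  inj {suc i} {zero}  eq = contradiction (sym eq) (x∉e i)
  inj {suc i} {suc j} eq = cong suc (e-inj eq)

support-injection : ∀ {n} k (f : Fin n → ℕ) → (∀ j → f j ≤ 1) → k ≤ ∑[ j < n ] f j →
                    Σ (Fin k → Fin n) λ e → Injective _≡_ _≡_ e × (∀ i → 1 ≤ f (e i))
support-injection zero    f f≤1 _ = [] , (λ { {()} }) , λ ()
support-injection {n} (suc k) f f≤1 k<∑f =
  let (x , 0<fx) = ∑-pigeonhole 0 f
                     (subst (_< ∑[ j < n ] f j) (sym (*-zeroʳ n)) (≤-trans (s≤s z≤n) k<∑f))
      (e , e-inj , e-pos) = support-injection k (λ j → f j * ν x j)
                              (λ j → *-mono-≤ (f≤1 j) (ν≤1 x j))
                              (≤-pred (≤-trans k<∑f (∑-remove f≤1 x)))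
      both i = 1≤m*n⇒1≤m∧1≤n (e-pos i)
  in x ∷ e
   , ∷-injective (λ i → 1≤ν⇒≢ (proj₂ (both i))) e-inj
   , λ { zero → 0<fx ; (suc i) → proj₁ (both i) }

falling₃ : ℕ → ℕ
falling₃ n = n * ((n ∸ 1) * (n ∸ 2))

-- falling₃ (m + 1) ∸ falling₃ m: the supporting line of the convex sequence
-- falling₃ through m and m + 1 has this slope.
slope : ℕ → ℕ
slope m = 3 * m * (m ∸ 1)

falling₃-supporting-line : ∀ m x → falling₃ m + slope m * x ≤ falling₃ x + slope m * m
falling₃-supporting-line 0 x = z≤n
falling₃-supporting-line 1 x = z≤n
falling₃-supporting-line (suc (suc u)) 0 = m+n≤o⇒m≤o _ (≤-reflexive (identity u))
  where
  identity : ∀ u → (2 + u) * ((1 + u) * u) + 3 * (2 + u) * (1 + u) * 0 + (2 + u) * (1 + u) * (2 * u + 6)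
                 ≡ 0 + 3 * (2 + u) * (1 + u) * (2 + u)
  identity = solve-∀
falling₃-supporting-line (suc (suc u)) 1 = m+n≤o⇒m≤o _ (≤-reflexive (identity u))
  where
  identity : ∀ u → (2 + u) * ((1 + u) * u) + 3 * (2 + u) * (1 + u) * 1 + (2 + u) * (1 + u) * (2 * u + 3)
                 ≡ 1 * (0 * 0) + 3 * (2 + u) * (1 + u) * (2 + u)
  identity = solve-∀
falling₃-supporting-line (suc (suc u)) (suc (suc y)) with compare y u
... | less .y k = m+n≤o⇒m≤o _ (≤-reflexive (identity y k))
  where
  identity : ∀ y k →
    (3 + (y + k)) * ((2 + (y + k)) * (1 + (y + k))) + 3 * (3 + (y + k)) * (2 + (y + k)) * (2 + y)
      + (1 + k) * ((1 + k) * (3 + 3 * y + 2 * (1 + k)) + 4 + 3 * y + 3 * (1 + k))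
    ≡ (2 + y) * ((1 + y) * y) + 3 * (3 + (y + k)) * (2 + (y + k)) * (3 + (y + k))
  identity = solve-∀
... | equal .u = ≤-refl
... | greater .u k = m+n≤o⇒m≤o _ (≤-reflexive (identity u k))
  where
  identity : ∀ u k →
    (2 + u) * ((1 + u) * u) + 3 * (2 + u) * (1 + u) * (3 + (u + k))
      + (1 + k) * (k * (3 * u + 4) + (1 + k) * k)
    ≡ (3 + (u + k)) * ((2 + (u + k)) * (1 + (u + k))) + 3 * (2 + u) * (1 + u) * (2 + u)
  identity = solve-∀

falling₃-jensen : ∀ {r} m (g : Fin r → ℕ) → ∑[ c < r ] g c ≡ r * m →
                  r * falling₃ m ≤ ∑[ c < r ] falling₃ (g c)
falling₃-jensen {r} m g ∑g≡rm = +-cancelʳ-≤ (r * (slope m * m)) (r * falling₃ m) ∑F (begin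
  r * falling₃ m + r * (slope m * m)
    ≡⟨ cong (r * falling₃ m +_) (rearrange (slope m) r m) ⟩
  r * falling₃ m + slope m * (r * m)
    ≡⟨ cong₂ (λ s t → s + slope m * t) (sym (∑-const r _)) (sym ∑g≡rm) ⟩
  ∑[ c < r ] falling₃ m + slope m * ∑[ c < r ] g c
    ≡⟨ cong (∑[ c < r ] falling₃ m +_) (*-distribˡ-sum (slope m) g) ⟩
  ∑[ c < r ] falling₃ m + ∑[ c < r ] (slope m * g c)
    ≡⟨ ∑-distrib-+ (λ _ → falling₃ m) (λ c → slope m * g c) ⟨
  ∑[ c < r ] (falling₃ m + slope m * g c)
    ≤⟨ ∑-mono-≤ (λ c → falling₃-supporting-line m (g c)) ⟩
  ∑[ c < r ] (falling₃ (g c) + slope m * m)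
    ≡⟨ ∑-distrib-+ (falling₃ ∘ g) (λ _ → slope m * m) ⟩
  ∑F + ∑[ c < r ] (slope m * m)
    ≡⟨ cong (∑F +_) (∑-const r (slope m * m)) ⟩
  ∑F + r * (slope m * m) ∎)
  where
  open ≤-Reasoning
  ∑F = ∑[ c < r ] falling₃ (g c)
  rearrange : ∀ a r m → r * (a * m) ≡ a * (r * m)
  rearrange = solve-∀

-- For 0/1-valued a, the indicator of x, y, z being distinct points of the
-- support of a, bracketed so that summing over z, y, x peels off one factor
-- at a time.
triple : ∀ {n} → (Fin n → ℕ) → Fin n → Fin n → Fin n → ℕ
triple a x y z = a x * (a y * ν x y) * (a z * ν x z * ν y z)

triple≤1 : ∀ {n} {a : Fin n → ℕ} → (∀ x → a x ≤ 1) → ∀ x y z → triple a x y z ≤ 1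
triple≤1 a≤1 x y z =
  *-mono-≤ (*-mono-≤ (a≤1 x) (*-mono-≤ (a≤1 y) (ν≤1 x y)))
           (*-mono-≤ (*-mono-≤ (a≤1 z) (ν≤1 x z)) (ν≤1 y z))

triple-support : ∀ {n} (a : Fin n → ℕ) {x y z} → 1 ≤ triple a x y z →
                 Injective _≡_ _≡_ (x ∷ y ∷ z ∷ []) × (∀ i → 1 ≤ a ((x ∷ y ∷ z ∷ []) i))
triple-support a p =
  let (p-xy , p-z)  = 1≤m*n⇒1≤m∧1≤n p
      (p-x , p-y)   = 1≤m*n⇒1≤m∧1≤n p-xy
      (p-y′ , y≢x) = 1≤m*n⇒1≤m∧1≤n p-y
      (p-zx , z≢y)  = 1≤m*n⇒1≤m∧1≤n p-z
      (p-z′ , z≢x) = 1≤m*n⇒1≤m∧1≤n p-zx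
  in ∷-injective (λ { zero → 1≤ν⇒≢ y≢x ; (suc zero) → 1≤ν⇒≢ z≢x ; (suc (suc ())) })
       (∷-injective (λ { zero → 1≤ν⇒≢ z≢y ; (suc ()) }) (∷-injective (λ ()) λ { {()} }))
   , λ { zero → p-x ; (suc zero) → p-y′ ; (suc (suc zero)) → p-z′ }

triple-count : ∀ {n} {a : Fin n → ℕ} → (∀ x → a x ≤ 1) →
               falling₃ (∑[ x < n ] a x) ≤ ∑[ x < n ] ∑[ y < n ] ∑[ z < n ] triple a x y z
triple-count {n} {a} a≤1 = begin
  d * ((d ∸ 1) * (d ∸ 2))
    ≡⟨ *-distribʳ-sum _ a ⟩
  ∑[ x < n ] (a x * ((d ∸ 1) * (d ∸ 2)))
    ≡⟨ sum-cong-≗ (λ x → sym (*-assoc (a x) _ _)) ⟩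
  ∑[ x < n ] (a x * (d ∸ 1) * (d ∸ 2))
    ≤⟨ ∑-mono-≤ (λ x → *-monoˡ-≤ (d ∸ 2) (*-monoʳ-≤ (a x) (after-one x))) ⟩
  ∑[ x < n ] (a x * ∑[ y < n ] (a y * ν x y) * (d ∸ 2))
    ≡⟨ sum-cong-≗ (λ x → trans (cong (_* (d ∸ 2)) (*-distribˡ-sum (a x) (λ y → a y * ν x y)))
                              (*-distribʳ-sum (d ∸ 2) (λ y → a x * (a y * ν x y)))) ⟩
  ∑[ x < n ] ∑[ y < n ] (a x * (a y * ν x y) * (d ∸ 2))
    ≤⟨ ∑-mono-≤ (λ x → ∑-mono-≤ (λ y → *-monoʳ-≤ (a x * (a y * ν x y)) (after-two x y))) ⟩
  ∑[ x < n ] ∑[ y < n ] (a x * (a y * ν x y) * ∑[ z < n ] (a z * ν x z * ν y z))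
    ≡⟨ sum-cong-≗ (λ x → sum-cong-≗ λ y →
         *-distribˡ-sum (a x * (a y * ν x y)) (λ z → a z * ν x z * ν y z)) ⟩
  ∑[ x < n ] ∑[ y < n ] ∑[ z < n ] triple a x y z ∎
  where
  open ≤-Reasoning
  d = ∑[ x < n ] a x
  after-one : ∀ x → d ∸ 1 ≤ ∑[ y < n ] (a y * ν x y)
  after-one x = m≤n+o⇒m∸n≤o d 1 (∑-remove a≤1 x)
  after-two : ∀ x y → d ∸ 2 ≤ ∑[ z < n ] (a z * ν x z * ν y z)
  after-two x y = m≤n+o⇒m∸n≤o d 2
    (≤-trans (∑-remove a≤1 x) (+-monoʳ-≤ 1 (∑-remove (λ z → *-mono-≤ (a≤1 z) (ν≤1 x z)) y)))

module Counting {r N : ℕ} (χ : EdgeColouring r N) where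

  colourClass : Fin N → Fin r → Fin N → ℕ
  colourClass j c x = δ (χ x j) c

  weight : Fin N → Fin r → Fin N → Fin N → Fin N → ℕ
  weight j c = triple (colourClass j c)

  codegree : Fin r → Fin N → Fin N → Fin N → ℕ
  codegree c x y z = ∑[ j < N ] weight j c x y z

  colourClass-partition : ∀ j → ∑[ c < r ] ∑[ x < N ] colourClass j c x ≡ N
  colourClass-partition j = begin
    ∑[ c < r ] ∑[ x < N ] δ (χ x j) c  ≡⟨ ∑-comm (λ c x → δ (χ x j) c) ⟩
    ∑[ x < N ] ∑[ c < r ] δ (χ x j) c  ≡⟨ sum-cong-≗ (λ x → ∑-δ (χ x j)) ⟩
    ∑[ x < N ] 1                       ≡⟨ ∑-const N 1 ⟩
    N * 1                              ≡⟨ *-identityʳ N ⟩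
    N                                  ∎
    where open ≡-Reasoning

  monochromatic-triples-lower : ∀ m → N ≡ r * m →
    N * (r * falling₃ m) ≤ ∑[ j < N ] ∑[ c < r ] ∑[ x < N ] ∑[ y < N ] ∑[ z < N ] weight j c x y z
  monochromatic-triples-lower m N≡rm =
    ≤-trans (≤-reflexive (sym (∑-const N (r * falling₃ m)))) (∑-mono-≤ λ j →
      ≤-trans (falling₃-jensen m (λ c → ∑[ x < N ] colourClass j c x)
                               (trans (colourClass-partition j) N≡rm))
              (∑-mono-≤ λ c → triple-count (λ x → δ≤1 (χ x j) c)))

  monochromatic-triples-by-codegree :
    ∑[ j < N ] ∑[ c < r ] ∑[ x < N ] ∑[ y < N ] ∑[ z < N ] weight j c x y z
    ≡ ∑[ c < r ] ∑[ x < N ] ∑[ y < N ] ∑[ z < N ] codegree c x y z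
  monochromatic-triples-by-codegree = begin
    ∑[ j < N ] ∑[ c < r ] ∑[ x < N ] ∑[ y < N ] ∑[ z < N ] weight j c x y z
      ≡⟨ ∑-comm (λ j c → ∑[ x < N ] ∑[ y < N ] ∑[ z < N ] weight j c x y z) ⟩
    ∑[ c < r ] ∑[ j < N ] ∑[ x < N ] ∑[ y < N ] ∑[ z < N ] weight j c x y z
      ≡⟨ sum-cong-≗ (λ c → ∑-comm (λ j x → ∑[ y < N ] ∑[ z < N ] weight j c x y z)) ⟩
    ∑[ c < r ] ∑[ x < N ] ∑[ j < N ] ∑[ y < N ] ∑[ z < N ] weight j c x y z
      ≡⟨ sum-cong-≗ (λ c → sum-cong-≗ λ x → ∑-comm (λ j y → ∑[ z < N ] weight j c x y z)) ⟩
    ∑[ c < r ] ∑[ x < N ] ∑[ y < N ] ∑[ j < N ] ∑[ z < N ] weight j c x y z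
      ≡⟨ sum-cong-≗ (λ c → sum-cong-≗ λ x → sum-cong-≗ λ y → ∑-comm (λ j z → weight j c x y z)) ⟩
    ∑[ c < r ] ∑[ x < N ] ∑[ y < N ] ∑[ z < N ] codegree c x y z ∎
    where open ≡-Reasoning

  codegree>2⇒mono : ∀ {c x y z} → 2 < codegree c x y z → MonoLR χ 3 3
  codegree>2⇒mono {c} {x} {y} {z} large =
    let (b , b-inj , b-pos) = support-injection 3 (λ j → weight j c x y z)
                                (λ j → triple≤1 (λ x → δ≤1 (χ x j) c) x y z) large
        left j = triple-support (colourClass (b j) c) (b-pos j)
    in c , x ∷ y ∷ z ∷ [] , b , proj₁ (left zero) , b-inj , λ i j → 1≤δ⇒≡ (proj₂ (left j) i)

  many-monochromatic-triples⇒mono :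
    r * (N * (N * (N * 2))) < ∑[ c < r ] ∑[ x < N ] ∑[ y < N ] ∑[ z < N ] codegree c x y z →
    MonoLR χ 3 3
  many-monochromatic-triples⇒mono large =
    let (c , large-c) = ∑-pigeonhole (N * (N * (N * 2)))
                          (λ c → ∑[ x < N ] ∑[ y < N ] ∑[ z < N ] codegree c x y z) large
        (x , large-x) = ∑-pigeonhole (N * (N * 2)) (λ x → ∑[ y < N ] ∑[ z < N ] codegree c x y z) large-c
        (y , large-y) = ∑-pigeonhole (N * 2) (λ y → ∑[ z < N ] codegree c x y z) large-x
        (z , large-z) = ∑-pigeonhole 2 (codegree c x y) large-y
    in codegree>2⇒mono large-z

counting-gap : ∀ r m .{{_ : NonZero r}} → 2 * ((r * m) * (r * m)) < falling₃ m →
          r * ((r * m) * ((r * m) * ((r * m) * 2))) < (r * m) * (r * falling₃ m)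
counting-gap r zero    large = contradiction large n≮0
counting-gap r (suc m) large = subst₂ _<_ (rearrange r N) (rearrange′ r N (falling₃ (suc m)))
  (*-monoʳ-< (N * r) {{m*n≢0 N r {{m*n≢0 r (suc m)}}}} large)
  where
  N = r * suc m
  rearrange : ∀ r N → N * r * (2 * (N * N)) ≡ r * (N * (N * (N * 2)))
  rearrange = solve-∀
  rearrange′ : ∀ r N f → N * r * f ≡ N * (r * f)
  rearrange′ = solve-∀

ramsey-K₃₃ : ∀ r m .{{_ : NonZero r}} → 2 * ((r * m) * (r * m)) < falling₃ m → RamseyProp r 3 3 (r * m)
ramsey-K₃₃ r m large χ = inj₁ (many-monochromatic-triples⇒mono
  (<-≤-trans (counting-gap r m large)
    (subst (_ ≤_) monochromatic-triples-by-codegree (monochromatic-triples-lower m refl))))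
  where open Counting χ

Searchable : (A : Set) → (A → A → Set) → Set₁
Searchable A _≈_ = ∀ {P : Pred A 0ℓ} → P Respects _≈_ → Decidable P → Dec (∃ P)

Fin-searchable : ∀ n → Searchable (Fin n) _≡_
Fin-searchable n _ = any?

→-searchable : ∀ {A : Set} {_≈_ : A → A → Set} → Reflexive _≈_ → Searchable A _≈_ →
               ∀ n → Searchable (Fin n → A) (Pointwise _≈_)
→-searchable ≈-refl search zero {P} resp P? with P? []
... | yes p = yes ([] , p)
... | no ¬p = no λ (f , pf) → ¬p (resp (λ ()) pf)
→-searchable {A} {_≈_} ≈-refl search (suc n) {P} resp P? with search resp-head extensible?
  where
  Extensible : A → Set
  Extensible x = ∃ λ f → P (x ∷ f)
  resp-head : Extensible Respects _≈_
  resp-head x≈y (f , p) = f , resp (λ { zero → x≈y ; (suc i) → ≈-refl }) p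
  extensible? : Decidable Extensible
  extensible? x = →-searchable ≈-refl search n
    (λ f≈g → resp (λ { zero → ≈-refl ; (suc i) → f≈g i })) (P? ∘ (x ∷_))
... | yes (x , f , p) = yes (x ∷ f , p)
... | no ∄ = no λ (f , p) → ∄ (head f , tail f , resp (λ { zero → ≈-refl ; (suc i) → ≈-refl }) p)

injective? : ∀ {m n} (f : Fin m → Fin n) → Dec (Injective _≡_ _≡_ f)
injective? f = map′ (λ inj {i} {j} → inj i j) (λ inj i j → inj {i} {j})
  (all? λ i → all? λ j → (f i ≟ᶠ f j) →-dec (i ≟ᶠ j))

MonoOn : ∀ {r N s t} → EdgeColouring r N → Fin r → (Fin s → Fin N) → (Fin t → Fin N) → Set
MonoOn χ c a b = Injective _≡_ _≡_ a × Injective _≡_ _≡_ b × (∀ i j → χ (a i) (b j) ≡ c)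

monoOn? : ∀ {r N s t} (χ : EdgeColouring r N) c a b → Dec (MonoOn {s = s} {t} χ c a b)
monoOn? χ c a b = injective? a ×-dec injective? b ×-dec all? λ i → all? λ j → χ (a i) (b j) ≟ᶠ c

monoOn-resp : ∀ {r N s t} {χ χ′ : EdgeColouring r N} {c}
                {a a′ : Fin s → Fin N} {b b′ : Fin t → Fin N} →
              (∀ x y → χ x y ≡ χ′ x y) → a ≗ a′ → b ≗ b′ → MonoOn χ c a b → MonoOn χ′ c a′ b′
monoOn-resp {χ = χ} {χ′} {c} {a} {a′} {b} {b′} χ≗χ′ a≗a′ b≗b′ (a-inj , b-inj , mono) =
  (λ eq → a-inj (trans (a≗a′ _) (trans eq (sym (a≗a′ _)))))
  , (λ eq → b-inj (trans (b≗b′ _) (trans eq (sym (b≗b′ _)))))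
  , λ i j → begin
      χ′ (a′ i) (b′ j) ≡⟨ cong₂ χ′ (a≗a′ i) (b≗b′ j) ⟨
      χ′ (a i) (b j)   ≡⟨ χ≗χ′ (a i) (b j) ⟨
      χ (a i) (b j)    ≡⟨ mono i j ⟩
      c                ∎
  where open ≡-Reasoning

monoLR? : ∀ {r N} (χ : EdgeColouring r N) s t → Dec (MonoLR χ s t)
monoLR? {N = N} χ s t = any? λ c →
  maps s (λ a≗a′ (b , mono) →
            b , monoOn-resp {χ = χ} {χ} (λ _ _ → refl) a≗a′ (λ _ → refl) mono) λ a →
  maps t (monoOn-resp {χ = χ} {χ} (λ _ _ → refl) (λ _ → refl)) λ b →
  monoOn? χ c a b
  where
  maps : ∀ n → Searchable (Fin n → Fin N) _≗_
  maps = →-searchable refl (Fin-searchable N)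

monoLR-resp : ∀ {r N s t} {χ χ′ : EdgeColouring r N} → (∀ x y → χ x y ≡ χ′ x y) →
              MonoLR χ s t → MonoLR χ′ s t
monoLR-resp χ≗χ′ (c , a , b , mono) = c , a , b , monoOn-resp χ≗χ′ (λ _ → refl) (λ _ → refl) mono

hasMonoK-resp : ∀ {r N s t} {χ χ′ : EdgeColouring r N} → (∀ x y → χ x y ≡ χ′ x y) →
                HasMonoK χ s t → HasMonoK χ′ s t
hasMonoK-resp χ≗χ′ (inj₁ mono) = inj₁ (monoLR-resp χ≗χ′ mono)
hasMonoK-resp χ≗χ′ (inj₂ mono) = inj₂ (monoLR-resp (flip χ≗χ′) mono)

hasMonoK? : ∀ {r N} (χ : EdgeColouring r N) s t → Dec (HasMonoK χ s t)
hasMonoK? χ s t = monoLR? χ s t ⊎-dec monoLR? (flip χ) s t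

ramsey? : ∀ r s t M → Dec (RamseyProp r s t M)
ramsey? r s t M
  with colourings (λ χ≗χ′ → _∘ hasMonoK-resp (λ x y → sym (χ≗χ′ x y)))
                  (λ χ → ¬? (hasMonoK? χ s t))
  where
  colourings : Searchable (EdgeColouring r M) (Pointwise _≗_)
  colourings = →-searchable (λ _ → refl) (→-searchable refl (Fin-searchable r) M) M
... | yes (χ , ¬mono) = no λ ramsey → ¬mono (ramsey χ)
... | no ∄ = yes λ χ → decidable-stable (hasMonoK? χ s t) (λ ¬mono → ∄ (χ , ¬mono))

least-witness : ∀ {P : Pred ℕ 0ℓ} → Decidable P → ∀ {n} → P n →
                Σ ℕ λ m → (P m × (∀ k → k < m → ¬ P k)) × m ≤ n
least-witness {P} P? = <-rec Goal step _
  where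
  Goal : ℕ → Set
  Goal n = P n → Σ ℕ λ m → (P m × (∀ k → k < m → ¬ P k)) × m ≤ n
  step : ∀ n → (∀ {k} → k < n → Goal k) → Goal n
  step n rec pn with anyUpTo? P? n
  ... | no ∄ = n , (pn , λ k k<n pk → ∄ (k , k<n , pk)) , ≤-refl
  ... | yes (k , k<n , pk) =
    let (m , least , m≤k) = rec k<n pk in m , least , ≤-trans m≤k (<⇒≤ k<n)

propositionA2 : (r : ℕ) → 2 ≤ r →
    Σ ℕ λ N → IsBR r 3 3 N × N ≤ 4 * r ^ 3 + 1
propositionA2 (suc (suc s)) (s≤s (s≤s z≤n)) =
  let (N , isBR , N≤rm) = least-witness (ramsey? r 3 3) (ramsey-K₃₃ r m large)
  in N , isBR , ≤-trans N≤rm (≤-trans (≤-reflexive (rm≡4r³ s)) (m≤m+n _ 1))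
  where
  r = 2 + s
  -- m = 4r², so N = rm = 4r³
  m = 16 + 4 * (4 * s + s * s)
  rm≡4r³ : ∀ s → (2 + s) * (16 + 4 * (4 * s + s * s)) ≡ 4 * ((2 + s) * ((2 + s) * ((2 + s) * 1)))
  rm≡4r³ = solve-∀
  -- with p = 4s + s² = r² - 4:  m(m-1)(m-2) - 2(rm)² = 8r²(4r⁴ - 6r² + 1) = 8r²(41 + 26p + 4p²)
  excess : ∀ s →
    2 * (((2 + s) * (16 + 4 * (4 * s + s * s))) * ((2 + s) * (16 + 4 * (4 * s + s * s))))
      + 8 * (4 + (4 * s + s * s)) * (41 + 26 * (4 * s + s * s) + 4 * ((4 * s + s * s) * (4 * s + s * s)))
    ≡ (16 + 4 * (4 * s + s * s)) * ((15 + 4 * (4 * s + s * s)) * (14 + 4 * (4 * s + s * s)))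
  excess = solve-∀
  large : 2 * ((r * m) * (r * m)) < falling₃ m
  large = ≤-trans (m<m+n _ z<s) (≤-reflexive (excess s))
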